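{- Let $G=(V,E)$ be an undirected graph on $n$ vertices with integer edge weights in $\{1,\dots,W\}$, and let $S\subseteq V$. Let $H$ be the subgraph produced by the following two-phase construction. Clustering phase: set $\beta=\log_n\sqrt{|S|W}$. Initially every vertex is unclustered and $G_{\mathcal C}$ is empty. While there is a vertex $v$ with at least $\lceil n^\beta\rceil$ unclustered neighbors, form a cluster $C$ consisting of exactly $\lceil n^\beta\rceil$ unclustered neighbors of $v$ (so $v\notin C$), add $C$ to the clustering $\mathcal C$, mark its vertices clustered, and add to $G_{\mathcal C}$ all edges $vx$ ($x\in C$) and all edges $xy$ of $G$ with $x,y\in C$. When no such $v$ remains, add all still-unclustered vertices and all their incident edges to $G_{\mathcal C}$. Path-buying phase: let $z=\binom{|S|}{2}$ and let $\pi_1,\dots,\pi_z$ be fixed shortest paths in $G$ between the unordered pairs of vertices of $S$, where $\pi_i$ has endpoints $u_i,v_i$. Set $G_0=G_{\mathcal C}$. For $i=1,\dots,z$: let $\mathrm{cost}(\pi_i)$ be the number of edges of $\pi_i$ not in $G_{i-1}$, and let $\mathrm{value}(\pi_i)$ be the number of pairs $(x,C)$ with $x\in\{u_i,v_i\}$, $C\in\mathcal C$, $C$ containing at least one vertex of $\pi_i$, and $\mathrm{dist}_{\pi_i}(x,C)<\mathrm{dist}_{G_{i-1}}(x,C)$. If $\mathrm{cost}(\pi_i)\le (2W+1)\,\mathrm{value}(\pi_i)$ set $G_i=G_{i-1}\cup\pi_i$, otherwise $G_i=G_{i-1}$. Finally $H=G_z$. Then for every $i\in\{1,\dots,z\}$,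 $\mathrm{dist}_H(u_i,v_i)\le \mathrm{dist}_G(u_i,v_i)+2W$; that is, for all $u,v\in S$, $\mathrm{dist}_H(u,v)\le\mathrm{dist}_G(u,v)+2W$.
   Context: $\mathrm{dist}_X(a,b)$ denotes the weighted shortest-path distance in the (sub)graph or path $X$; for a set $C$ of vertices, $\mathrm{dist}_X(x,C)=\min_{y\in C}\mathrm{dist}_X(x,y)$ (for $X=\pi_i$, distance measured along the path $\pi_i$ to the vertices of $C$ lying on it). A clustering is a collection of pairwise disjoint vertex subsets. -}

module Defs where

open import Data.Nat using (ℕ; zero; suc; _+_; _*_; _≤_; _<_)
open import Data.Bool using (Bool; true; false; _∧_; _∨_; not; if_then_else_)
open import Data.Fin using (Fin; _≟_)
open import Data.List using (List; []; _∷_; _++_; length; allFin)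
open import Data.Bool.ListAction using (any)
open import Data.List.Membership.Propositional using (_∈_)
open import Data.List.Relation.Unary.Unique.Propositional using (Unique)
open import Data.Product using (Σ; ∃; _×_; _,_)
open import Data.Sum using (_⊎_)
open import Data.Empty using (⊥)
open import Data.Unit using (⊤)
open import Relation.Nullary using (¬_)
open import Relation.Nullary.Decidable using (⌊_⌋)
open import Relation.Binary.PropositionalEquality using (_≡_)
open import Function.Bundles using (_⇔_)

-- Basic notions.  Vertices are Fin n.  An edge set (of G or of a
-- spanning subgraph of G) is a Boolean adjacency function.  All
-- subgraphs carry the weights w of G.

EdgeSet : ℕ → Set
EdgeSet n = Fin n → Fin n → Bool

_==_ : ∀ {n} → Fin n → Fin n → Bool
a == b = ⌊ a ≟ b ⌋

memb : ∀ {n} → Fin n → List (Fin n) → Bool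
memb x C = any (x ==_) C

countᵇ : ∀ {A : Set} → (A → Bool) → List A → ℕ
countᵇ p [] = 0
countᵇ p (x ∷ xs) = (if p x then 1 else 0) + countᵇ p xs

IsWeightedGraph : ∀ {n} → EdgeSet n → (Fin n → Fin n → ℕ) → ℕ → Set
IsWeightedGraph {n} E w W =
  (∀ a b → E a b ≡ E b a) × (∀ a → E a a ≡ false) ×
  (∀ a b → w a b ≡ w b a) ×
  (∀ a b → E a b ≡ true → (1 ≤ w a b) × (w a b ≤ W))

card : ∀ {n} → (Fin n → Bool) → ℕ
card {n} S = countᵇ S (allFin n)

IsCeilSqrt : ℕ → ℕ → Set
IsCeilSqrt m k = (m ≤ k * k) × (∀ j → m ≤ j * j → k ≤ j)

-- Walks given by vertex lists.  WalkL E a xs c : the walk a, xs… in E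
-- ends at c (xs lists the vertices after a).

data WalkL {n} (E : EdgeSet n) : Fin n → List (Fin n) → Fin n → Set where
  stop : ∀ {a} → WalkL E a [] a
  step : ∀ {a b xs c} → E a b ≡ true → WalkL E b xs c → WalkL E a (b ∷ xs) c

wt : ∀ {n} → (Fin n → Fin n → ℕ) → Fin n → List (Fin n) → ℕ
wt w a [] = 0
wt w a (b ∷ xs) = w a b + wt w b xs

pathE : ∀ {n} → Fin n → List (Fin n) → EdgeSet n
pathE a [] x y = false
pathE a (b ∷ xs) x y =
  ((a == x ∧ b == y) ∨ (a == y ∧ b == x)) ∨ pathE b xs x y

_∪E_ : ∀ {n} → EdgeSet n → EdgeSet n → EdgeSet n
(E ∪E F) a b = E a b ∨ F a b

cost : ∀ {n} → EdgeSet n → Fin n → List (Fin n) → ℕ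
cost E a [] = 0
cost E a (b ∷ xs) = (if E a b then 0 else 1) + cost E b xs

data ℕ∞ : Set where
  fin : ℕ → ℕ∞
  ∞   : ℕ∞

_<∞_ : ℕ∞ → ℕ∞ → Set
fin a <∞ fin b = a < b
fin a <∞ ∞     = ⊤
∞     <∞ _     = ⊥

DistTo : ∀ {n} → EdgeSet n → (Fin n → Fin n → ℕ) → Fin n → List (Fin n) → ℕ∞ → Set
DistTo {n} E w a C (fin d) =
  (Σ (List (Fin n)) λ xs → Σ (Fin n) λ c → c ∈ C × WalkL E a xs c × wt w a xs ≡ d) ×
  (∀ xs c → c ∈ C → WalkL E a xs c → d ≤ wt w a xs)
DistTo {n} E w a C ∞ = ∀ xs c → c ∈ C → WalkL E a xs c → ⊥

Card : {A : Set} → (A → Set) → ℕ → Set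
Card {A} P k = Σ (List A) λ L → Unique L × (∀ p → (p ∈ L) ⇔ P p) × length L ≡ k

record CState (n : ℕ) : Set where
  constructor cstate
  field
    clustered : Fin n → Bool
    clusters  : List (List (Fin n))
    edges     : EdgeSet n
open CState public

initC : ∀ {n} → CState n
initC = cstate (λ _ → false) [] (λ _ _ → false)

addCluster : ∀ {n} → EdgeSet n → CState n → Fin n → List (Fin n) → CState n
addCluster G s v C = cstate
  (λ x → clustered s x ∨ memb x C)
  (clusters s ++ (C ∷ []))
  (λ a b → edges s a b ∨ ((a == v ∧ memb b C) ∨ (b == v ∧ memb a C))
                       ∨ (G a b ∧ (memb a C ∧ memb b C)))

-- states reachable by the while loop with cluster size k
data ClusterRun {n} (G : EdgeSet n) (k : ℕ) : CState n → Set where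
  start : ClusterRun G k initC
  grow  : ∀ {s} → ClusterRun G k s → (v : Fin n) (C : List (Fin n)) →
          Unique C → length C ≡ k →
          (∀ x → x ∈ C → (G v x ≡ true) × (clustered s x ≡ false)) →
          ClusterRun G k (addCluster G s v C)

Terminal : ∀ {n} → EdgeSet n → ℕ → CState n → Set
Terminal {n} G k s = ∀ v → countᵇ (λ x → G v x ∧ not (clustered s x)) (allFin n) < k

finalEdges : ∀ {n} → EdgeSet n → CState n → EdgeSet n
finalEdges G s a b = edges s a b ∨ (G a b ∧ (not (clustered s a) ∨ not (clustered s b)))

-- Path-buying phase.  A path is (u , xs , v): the vertex list u, xs…
-- ending at v.

Path : ℕ → Set
Path n = Fin n × List (Fin n) × Fin n

ShortestPathSystem : ∀ {n} → EdgeSet n → (Fin n → Fin n → ℕ) → (Fin n → Bool) →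
                     List (Path n) → Set
ShortestPathSystem {n} G w S ps =
  (∀ u xs v → (u , xs , v) ∈ ps →
     (S u ≡ true) × (S v ≡ true) × ¬ (u ≡ v) × WalkL G u xs v ×
     (∀ ys → WalkL G u ys v → wt w u xs ≤ wt w u ys)) ×
  (∀ a b → S a ≡ true → S b ≡ true → ¬ (a ≡ b) →
     countᵇ (λ { (u , xs , v) → (u == a ∧ v == b) ∨ (u == b ∧ v == a) }) ps ≡ 1)

ValuePair : ∀ {n} → (Fin n → Fin n → ℕ) → List (List (Fin n)) → EdgeSet n →
            Path n → Fin n × List (Fin n) → Set
ValuePair {n} w 𝒞 E (u , xs , v) (x , C) =
  ((x ≡ u) ⊎ (x ≡ v)) × C ∈ 𝒞 ×
  (Σ (Fin n) λ y → y ∈ C × y ∈ (u ∷ xs)) ×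
  (Σ ℕ∞ λ d₁ → Σ ℕ∞ λ d₂ →
     DistTo (pathE u xs) w x C d₁ × DistTo E w x C d₂ × d₁ <∞ d₂)

BuyStep : ∀ {n} → (Fin n → Fin n → ℕ) → ℕ → List (List (Fin n)) →
          EdgeSet n → Path n → EdgeSet n → Set
BuyStep w W 𝒞 E (u , xs , v) E' =
  Σ ℕ λ val → Card (ValuePair w 𝒞 E (u , xs , v)) val ×
   (((cost E u xs ≤ (2 * W + 1) * val) × (∀ a b → E' a b ≡ (E ∪E pathE u xs) a b))
    ⊎ (((2 * W + 1) * val < cost E u xs) × (∀ a b → E' a b ≡ E a b)))

data BuyRun {n} (w : Fin n → Fin n → ℕ) (W : ℕ) (𝒞 : List (List (Fin n))) :
            EdgeSet n → List (Path n) → EdgeSet n → Set where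
  done : ∀ {E} → BuyRun w W 𝒞 E [] E
  buy  : ∀ {E E' H p ps} → BuyStep w W 𝒞 E p E' → BuyRun w W 𝒞 E' ps H →
         BuyRun w W 𝒞 E (p ∷ ps) H

-- Let π be the chosen shortest path between the endpoints, considered at stage i. If π is bought, it
-- lies in H. Otherwise some cluster C meeting π is valued by neither endpoint. Indeed, an edge of π
-- missing from G_{i-1} starts at a clustered vertex; if every cluster meeting π were valued, each such
-- edge would start in a valued cluster, and a valued cluster C accounts for at most 2W + 1 of them,
-- because two vertices of C are within 2W along π (go through the centre of C, π being shortest) and
-- weights are at least 1; so cost(π) ≤ (2W + 1) value(π), and π would have been bought. For a cluster
-- valued by neither endpoint, G_{i-1} reaches C from u no later than π does, and likewise from v;
-- joining these two walks through the centre of C costs at most 2W more than π.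
--
-- Distances to a cluster exist only classically, so the argument runs in the double-negation monad;
-- since weights are at least 1, having a walk of bounded weight is decidable, which removes the
-- double negation at the end.
module Submission where

open import Defs
open import Data.Nat using (ℕ; suc; _+_; _*_; _∸_; _≤_; _<_; z≤n; s≤s)
open import Data.Nat.Properties hiding (_≟_)
open import Data.Nat.Induction using (<-rec)
open import Data.Nat.Solver using (module +-*-Solver)
open import Data.Bool using (Bool; true; false; _∧_; _∨_; not; if_then_else_)
open import Data.Bool.Properties using (_≟_; ∨-zeroʳ; ∨-comm; ∧-comm; ∧-conicalˡ; ∧-conicalʳ; T-≡)
open import Data.Bool.ListAction using (any)
open import Data.Fin using (Fin)
import Data.Fin.Properties as Fin
open import Data.List using (List; []; _∷_; _++_; length)
open import Data.List.Membership.Propositional using (_∈_; lose)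
open import Data.List.Membership.Propositional.Properties using (∈-++⁺ˡ; ∈-++⁺ʳ; ∈-++⁻)
open import Data.List.Relation.Unary.Any as Any using (here; there)
open import Data.List.Relation.Unary.Any.Properties using (any⁺; any⁻)
open import Data.Product using (Σ; _×_; _,_; proj₁; proj₂)
open import Data.Sum using (_⊎_; inj₁; inj₂; [_,_])
open import Data.Unit using (tt)
open import Effect.Monad using (RawMonad)
import Level
open import Function using (_∘_)
open import Function.Bundles using (Equivalence)
open import Relation.Nullary using (¬_; Dec; yes; no)
open import Relation.Nullary.Decidable using (toWitness; fromWitness; map′; decidable-stable; ¬¬-excluded-middle)
open import Relation.Nullary.Negation using (¬¬-Monad; ¬¬-map; contradiction)
open import Relation.Binary.PropositionalEquality hiding ([_])

open RawMonad (¬¬-Monad {Level.zero}) using (pure; _>>=_)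

∨-true⁻ : ∀ x {y} → x ∨ y ≡ true → x ≡ true ⊎ y ≡ true
∨-true⁻ true  _ = inj₁ refl
∨-true⁻ false e = inj₂ e

∨-trueˡ : ∀ {x} y → x ≡ true → x ∨ y ≡ true
∨-trueˡ _ refl = refl

∨-trueʳ : ∀ x {y} → y ≡ true → x ∨ y ≡ true
∨-trueʳ x refl = ∨-zeroʳ x

∧-true : ∀ {x y} → x ≡ true → y ≡ true → x ∧ y ≡ true
∧-true refl refl = refl

==⇒≡ : ∀ {n} (a b : Fin n) → (a == b) ≡ true → a ≡ b
==⇒≡ a b e = toWitness (Equivalence.from T-≡ e)

==-refl : ∀ {n} (a : Fin n) → (a == a) ≡ true
==-refl a = Equivalence.to T-≡ (fromWitness {a? = a Fin.≟ a} refl)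

memb⇒∈ : ∀ {n} {x : Fin n} C → memb x C ≡ true → x ∈ C
memb⇒∈ {x = x} C e = Any.map (λ {c} t → toWitness {a? = x Fin.≟ c} t) (any⁻ _ C (Equivalence.from T-≡ e))

any-true : ∀ {A : Set} (p : A → Bool) {x xs} → x ∈ xs → p x ≡ true → any p xs ≡ true
any-true p x∈ px = Equivalence.to T-≡ (any⁺ p (lose x∈ (Equivalence.from T-≡ px)))

∈⇒memb : ∀ {n} {x : Fin n} {C} → x ∈ C → memb x C ≡ true
∈⇒memb {x = x} x∈ = any-true (x ==_) x∈ (==-refl x)

countᵇ-pos⇒∃ : ∀ {A : Set} (p : A → Bool) xs → 0 < countᵇ p xs → Σ A λ x → x ∈ xs × p x ≡ true
countᵇ-pos⇒∃ p (x ∷ xs) pos with p x in eq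
... | true  = x , here refl , eq
... | false with countᵇ-pos⇒∃ p xs pos
...   | y , y∈ , py = y , there y∈ , py

module _ {n : ℕ} where

  _⊆E_ : EdgeSet n → EdgeSet n → Set
  E ⊆E F = ∀ a b → E a b ≡ true → F a b ≡ true

  SymmetricE : EdgeSet n → Set
  SymmetricE E = ∀ a b → E a b ≡ E b a

  ⊆E-trans : ∀ {E F H} → E ⊆E F → F ⊆E H → E ⊆E H
  ⊆E-trans E⊆F F⊆H a b = F⊆H a b ∘ E⊆F a b

  ⊆E-false : ∀ {E F} → E ⊆E F → ∀ {a b} → F a b ≡ false → E a b ≡ false
  ⊆E-false {E} E⊆F {a} {b} f with E a b in e
  ... | true  = contradiction (trans (sym (E⊆F a b e)) f) λ ()
  ... | false = refl

  last : Fin n → List (Fin n) → Fin n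
  last a []       = a
  last a (b ∷ xs) = last b xs

  ∈⇒split : ∀ {y} a xs → y ∈ a ∷ xs →
            Σ (List (Fin n)) λ p → Σ (List (Fin n)) λ q → xs ≡ p ++ q × last a p ≡ y
  ∈⇒split a xs       (here refl) = [] , xs , refl , refl
  ∈⇒split a (b ∷ xs) (there y∈)  with ∈⇒split b xs y∈
  ... | p , q , refl , eq = b ∷ p , q , refl , eq

  wt-++ : ∀ (w : Fin n → Fin n → ℕ) a p q → wt w a (p ++ q) ≡ wt w a p + wt w (last a p) q
  wt-++ w a []      q = refl
  wt-++ w a (b ∷ p) q = trans (cong (w a b +_) (wt-++ w b p q)) (sym (+-assoc (w a b) _ _))

  Shortest : (Fin n → Fin n → ℕ) → EdgeSet n → Fin n → List (Fin n) → Fin n → Set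
  Shortest w E a xs b = ∀ ys → WalkL E a ys b → wt w a xs ≤ wt w a ys

  module _ {E : EdgeSet n} where

    walk-last : ∀ {a xs c} → WalkL E a xs c → last a xs ≡ c
    walk-last stop        = refl
    walk-last (step _ wk) = walk-last wk

    walk-++ : ∀ {a p b q c} → WalkL E a p b → WalkL E b q c → WalkL E a (p ++ q) c
    walk-++ stop         wq = wq
    walk-++ (step e wp)  wq = step e (walk-++ wp wq)

    walk-++⁻ : ∀ {a} p {q c} → WalkL E a (p ++ q) c → WalkL E a p (last a p) × WalkL E (last a p) q c
    walk-++⁻ []      wk          = stop , wk
    walk-++⁻ (b ∷ p) (step e wk) with walk-++⁻ p wk
    ... | wp , wq = step e wp , wq

    walk-mono : ∀ {F} → E ⊆E F → ∀ {a xs c} → WalkL E a xs c → WalkL F a xs c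
    walk-mono E⊆F stop        = stop
    walk-mono E⊆F (step e wk) = step (E⊆F _ _ e) (walk-mono E⊆F wk)

    walk-reverse : (w : Fin n → Fin n → ℕ) → SymmetricE E → (∀ a b → w a b ≡ w b a) →
                   ∀ {a xs c} → WalkL E a xs c →
                   Σ (List (Fin n)) λ ys → WalkL E c ys a × wt w c ys ≡ wt w a xs
    walk-reverse w symE symw stop = [] , stop , refl
    walk-reverse w symE symw {a} (step {b = b} {xs = xs} {c = c} e wk) with walk-reverse w symE symw wk
    ... | ys , wys , eq = ys ++ a ∷ [] , walk-++ wys (step (trans (symE b a) e) stop) , (begin
      wt w c (ys ++ a ∷ [])            ≡⟨ wt-++ w c ys (a ∷ []) ⟩
      wt w c ys + (w (last c ys) a + 0) ≡⟨ cong₂ (λ l v → l + (w v a + 0)) eq (walk-last wys) ⟩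
      wt w b xs + (w b a + 0)          ≡⟨ cong (wt w b xs +_) (trans (+-identityʳ _) (symw b a)) ⟩
      wt w b xs + w a b                ≡⟨ +-comm (wt w b xs) _ ⟩
      w a b + wt w b xs                ∎)
      where open ≡-Reasoning

  pathE-walk : ∀ a xs → WalkL (pathE a xs) a xs (last a xs)
  pathE-walk a []       = stop
  pathE-walk a (b ∷ xs) =
    step (∨-trueˡ _ (∨-trueˡ _ (∧-true (==-refl a) (==-refl b))))
         (walk-mono (λ x y → ∨-trueʳ _) (pathE-walk b xs))

  walk⇒pathE-walk : ∀ {E a xs c} → WalkL E a xs c → WalkL (pathE a xs) a xs c
  walk⇒pathE-walk {a = a} {xs} wk = subst (WalkL (pathE a xs) a xs) (walk-last wk) (pathE-walk a xs)

  pathE-sym : ∀ a xs → SymmetricE (pathE a xs)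
  pathE-sym a []       x y = refl
  pathE-sym a (b ∷ xs) x y = cong₂ _∨_ (∨-comm (a == x ∧ b == y) _) (pathE-sym b xs x y)

  pathE-⊆ : ∀ {G : EdgeSet n} → SymmetricE G → ∀ {a xs c} → WalkL G a xs c → pathE a xs ⊆E G
  pathE-⊆ symG stop x y ()
  pathE-⊆ {G} symG {a} (step {b = b} e wk) x y p with ∨-true⁻ _ p
  ... | inj₂ p′ = pathE-⊆ symG wk x y p′
  ... | inj₁ p′ with ∨-true⁻ (a == x ∧ b == y) p′
  ...   | inj₁ q = subst₂ (λ u v → G u v ≡ true)
                          (==⇒≡ a x (∧-conicalˡ _ _ q)) (==⇒≡ b y (∧-conicalʳ _ _ q)) e
  ...   | inj₂ q = subst₂ (λ u v → G v u ≡ true)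
                          (==⇒≡ a y (∧-conicalˡ _ _ q)) (==⇒≡ b x (∧-conicalʳ _ _ q)) (trans (symG b a) e)

module Clustering {n} (G : EdgeSet n) (symG : SymmetricE G) (k : ℕ) where

  spoke-⊆ : ∀ {s v C} → (∀ x → x ∈ C → G v x ≡ true × clustered s x ≡ false) →
            ∀ a b → (a == v ∧ memb b C) ≡ true → G a b ≡ true
  spoke-⊆ {v = v} {C} nbrs a b q with ==⇒≡ a v (∧-conicalˡ _ _ q)
  ... | refl = proj₁ (nbrs b (memb⇒∈ C (∧-conicalʳ _ _ q)))

  clusterRun-⊆ : ∀ {s} → ClusterRun G k s → edges s ⊆E G
  clusterRun-⊆ start a b ()
  clusterRun-⊆ (grow {s} run v C _ _ nbrs) a b e with ∨-true⁻ (edges s a b) e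
  ... | inj₁ old = clusterRun-⊆ run a b old
  ... | inj₂ new with ∨-true⁻ _ new
  ...   | inj₂ inner = ∧-conicalˡ _ _ inner
  ...   | inj₁ spoke with ∨-true⁻ (a == v ∧ memb b C) spoke
  ...     | inj₁ q = spoke-⊆ {s} nbrs a b q
  ...     | inj₂ q = trans (symG a b) (spoke-⊆ {s} nbrs b a q)

  clusterRun-sym : ∀ {s} → ClusterRun G k s → SymmetricE (edges s)
  clusterRun-sym start a b = refl
  clusterRun-sym (grow run v C _ _ _) a b =
    cong₂ _∨_ (clusterRun-sym run a b)
              (cong₂ _∨_ (∨-comm (a == v ∧ memb b C) _) (cong₂ _∧_ (symG a b) (∧-comm (memb a C) _)))

  clustered⇒∈cluster : ∀ {s} → ClusterRun G k s → ∀ x → clustered s x ≡ true →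
                       Σ (List (Fin n)) λ C → C ∈ clusters s × x ∈ C
  clustered⇒∈cluster start x ()
  clustered⇒∈cluster (grow {s} run v C _ _ _) x e with ∨-true⁻ (clustered s x) e
  ... | inj₂ x∈C = C , ∈-++⁺ʳ (clusters s) (here refl) , memb⇒∈ C x∈C
  ... | inj₁ old with clustered⇒∈cluster run x old
  ...   | C′ , C′∈ , x∈C′ = C′ , ∈-++⁺ˡ C′∈ , x∈C′

  cluster-centre : ∀ {s} → ClusterRun G k s → ∀ {C} → C ∈ clusters s →
                   Σ (Fin n) λ v → ∀ x → x ∈ C → G v x ≡ true × edges s v x ≡ true
  cluster-centre start ()
  cluster-centre (grow {s} run v C _ _ nbrs) C′∈ with ∈-++⁻ (clusters s) C′∈
  ... | inj₂ (here refl) =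
    v , λ x x∈C → proj₁ (nbrs x x∈C) ,
                  ∨-trueʳ (edges s v x) (∨-trueˡ _ (∨-trueˡ _ (∧-true (==-refl v) (∈⇒memb x∈C))))
  ... | inj₁ old with cluster-centre run old
  ...   | c , centre = c , λ x x∈C → proj₁ (centre x x∈C) , ∨-trueˡ _ (proj₂ (centre x x∈C))

  finalEdges-⊆ : ∀ {s} → ClusterRun G k s → finalEdges G s ⊆E G
  finalEdges-⊆ {s} run a b e with ∨-true⁻ (edges s a b) e
  ... | inj₁ old   = clusterRun-⊆ run a b old
  ... | inj₂ added = ∧-conicalˡ _ _ added

  finalEdges-sym : ∀ {s} → ClusterRun G k s → SymmetricE (finalEdges G s)
  finalEdges-sym {s} run a b =
    cong₂ _∨_ (clusterRun-sym run a b) (cong₂ _∧_ (symG a b) (∨-comm (not (clustered s a)) _))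

  finalEdges-missing : ∀ s {a b} → G a b ≡ true → finalEdges G s a b ≡ false → clustered s a ≡ true
  finalEdges-missing s {a} {b} g e with clustered s a
  ... | true  = refl
  ... | false =
    contradiction (trans (sym e) (∨-trueʳ (edges s a b) (∧-true g (∨-trueˡ (not (clustered s b)) refl)))) λ ()

tailCount : ∀ {n} → (Fin n → Bool) → Fin n → List (Fin n) → ℕ
tailCount P a []       = 0
tailCount P a (b ∷ xs) = (if P a then 1 else 0) + tailCount P b xs

module _ {n : ℕ} where

  tailCount-false : ∀ (a : Fin n) xs → tailCount (λ _ → false) a xs ≡ 0
  tailCount-false a []       = refl
  tailCount-false a (b ∷ xs) = tailCount-false b xs

  tailCount-∨ : ∀ (P Q : Fin n → Bool) a xs →
                tailCount (λ y → P y ∨ Q y) a xs ≤ tailCount P a xs + tailCount Q a xs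
  tailCount-∨ P Q a []       = z≤n
  tailCount-∨ P Q a (b ∷ xs) with P a | Q a | tailCount-∨ P Q b xs
  ... | true  | true  | ih = s≤s (≤-trans ih (+-monoʳ-≤ _ (n≤1+n _)))
  ... | true  | false | ih = s≤s ih
  ... | false | true  | ih = ≤-trans (s≤s ih) (≤-reflexive (sym (+-suc _ _)))
  ... | false | false | ih = ih

  tailCount-any : ∀ {A : Set} (g : Fin n → A → Bool) L K a xs →
                  (∀ x → x ∈ L → tailCount (λ y → g y x) a xs ≤ K) →
                  tailCount (λ y → any (g y) L) a xs ≤ length L * K
  tailCount-any g []      K a xs bound = ≤-reflexive (tailCount-false a xs)
  tailCount-any g (x ∷ L) K a xs bound = ≤-trans (tailCount-∨ (λ y → g y x) (λ y → any (g y) L) a xs)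
    (+-mono-≤ (bound x (here refl)) (tailCount-any g L K a xs (λ x′ x′∈ → bound x′ (there x′∈))))

  cost≤tailCount : ∀ {G : EdgeSet n} E P {a xs c} →
                   (∀ y z → y ∈ a ∷ xs → G y z ≡ true → E y z ≡ false → P y ≡ true) →
                   WalkL G a xs c → cost E a xs ≤ tailCount P a xs
  cost≤tailCount E P missing stop = z≤n
  cost≤tailCount E P {a} missing (step {b = b} e wk)
    with E a b in eab | cost≤tailCount E P (λ y z → missing y z ∘ there) wk
  ... | true  | ih = ≤-trans ih (m≤n+m _ _)
  ... | false | ih rewrite missing a b (here refl) e eab = s≤s ih

indicator+-mono-≤ : ∀ t {m B} → m ≤ B → (if t then 1 else 0) + m ≤ (if t then suc B else B)
indicator+-mono-≤ true  m≤B = s≤s m≤B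
indicator+-mono-≤ false m≤B = m≤B

module _ {n} {G : EdgeSet n} (w : Fin n → Fin n → ℕ) (P : Fin n → Bool) where

  -- The counted vertices have distinct prefix weights in [0, B], and in [1, B] unless a is one of them.
  tailCount-within : (∀ a b → G a b ≡ true → 1 ≤ w a b) → ∀ B {a xs c} → WalkL G a xs c →
                     (∀ q r → xs ≡ q ++ r → P (last a q) ≡ true → wt w a q ≤ B) →
                     tailCount P a xs ≤ (if P a then suc B else B)
  tailCount-within pos B stop _ = z≤n
  tailCount-within pos B {a} (step {b = b} {xs = rest} e wk) within
    with P b in pb | tailCount-within pos (B ∸ w a b) wk (λ q r eq pq →
      m+n≤o⇒m≤o∸n (wt w b q)
        (≤-trans (≤-reflexive (+-comm (wt w b q) (w a b))) (within (b ∷ q) r (cong (b ∷_) eq) pq)))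
  ... | true  | ih = indicator+-mono-≤ (P a)
      (≤-trans ih (∸-monoʳ-< (pos a b e) (≤-trans (m≤m+n (w a b) 0) (within (b ∷ []) rest refl pb))))
  ... | false | ih = indicator+-mono-≤ (P a) (≤-trans ih (m∸n≤m B (w a b)))

  SpreadAtMost : ℕ → Fin n → List (Fin n) → Set
  SpreadAtMost K a xs = ∀ p q r → xs ≡ p ++ q ++ r →
    P (last a p) ≡ true → P (last (last a p) q) ≡ true → wt w (last a p) q ≤ K

  tailCount-spread : (∀ a b → G a b ≡ true → 1 ≤ w a b) → ∀ K {a xs c} → WalkL G a xs c →
                     SpreadAtMost K a xs → tailCount P a xs ≤ suc K
  tailCount-spread pos K stop _ = z≤n
  tailCount-spread pos K {a} wk@(step {b = b} {xs = rest} _ wk′) spread with P a in pa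
  ... | true  = subst (λ t → (if t then 1 else 0) + tailCount P b rest ≤ (if t then suc K else K)) pa
                      (tailCount-within pos K wk (λ q r eq → spread [] q r eq pa))
  ... | false = tailCount-spread pos K wk′ (λ p q r eq → spread (b ∷ p) q r (cong (b ∷_) eq))

  shortest⇒spread : ∀ {W cen} → SymmetricE G → (∀ a b → w a b ≡ w b a) →
                    (∀ x → P x ≡ true → G cen x ≡ true × w cen x ≤ W) →
                    ∀ {a xs b} → WalkL G a xs b → Shortest w G a xs b → SpreadAtMost (2 * W) a xs
  shortest⇒spread {W} {cen} symG symw centre {a} wk shortest p q r refl py py′ =
    +-cancelʳ-≤ (wt w y′ r) _ _ (+-cancelˡ-≤ (wt w a p) _ _ (begin
      wt w a p + (wt w y q + wt w y′ r)              ≡⟨ cong (wt w a p +_) (sym (wt-++ w y q r)) ⟩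
      wt w a p + wt w y (q ++ r)                     ≡⟨ sym (wt-++ w a p (q ++ r)) ⟩
      wt w a (p ++ q ++ r)                           ≤⟨ shortest _ shortcut ⟩
      wt w a (p ++ cen ∷ y′ ∷ r)                     ≡⟨ wt-++ w a p _ ⟩
      wt w a p + (w y cen + (w cen y′ + wt w y′ r))  ≤⟨ +-monoʳ-≤ (wt w a p) via-centre ⟩
      wt w a p + (2 * W + wt w y′ r)                 ∎))
    where
    open ≤-Reasoning
    y  = last a p
    y′ = last y q
    shortcut : WalkL G a (p ++ cen ∷ y′ ∷ r) _
    shortcut = walk-++ (proj₁ (walk-++⁻ p wk))
      (step (trans (symG y cen) (proj₁ (centre y py)))
        (step (proj₁ (centre y′ py′)) (proj₂ (walk-++⁻ q (proj₂ (walk-++⁻ p wk))))))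
    via-centre : w y cen + (w cen y′ + wt w y′ r) ≤ 2 * W + wt w y′ r
    via-centre = ≤-trans (≤-reflexive (sym (+-assoc (w y cen) _ _))) (+-monoˡ-≤ (wt w y′ r)
      (≤-trans (+-mono-≤ (≤-trans (≤-reflexive (symw y cen)) (proj₂ (centre y py))) (proj₂ (centre y′ py′)))
               (≤-reflexive (cong (W +_) (sym (+-identityʳ W))))))

module _ {n} (w : Fin n → Fin n → ℕ) where

  ShortWalk : EdgeSet n → Fin n → Fin n → ℕ → Set
  ShortWalk E a b ℓ = Σ (List (Fin n)) λ ys → WalkL E a ys b × wt w a ys ≤ ℓ

  WalkInto : EdgeSet n → Fin n → List (Fin n) → ℕ → Set
  WalkInto E x C ℓ = Σ (List (Fin n)) λ ys → Σ (Fin n) λ c → c ∈ C × WalkL E x ys c × wt w x ys ≤ ℓ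

  CloserIn : EdgeSet n → EdgeSet n → Fin n → List (Fin n) → Set
  CloserIn F E x C = Σ ℕ∞ λ d₁ → Σ ℕ∞ λ d₂ → DistTo F w x C d₁ × DistTo E w x C d₂ × d₁ <∞ d₂

  shortWalk-mono : ∀ {E F a b ℓ} → E ⊆E F → ShortWalk E a b ℓ → ShortWalk F a b ℓ
  shortWalk-mono E⊆F (ys , wk , ≤ℓ) = ys , walk-mono E⊆F wk , ≤ℓ

  shortWalk-weaken : ∀ {E a b ℓ ℓ′} → ℓ ≤ ℓ′ → ShortWalk E a b ℓ → ShortWalk E a b ℓ′
  shortWalk-weaken ℓ≤ℓ′ (ys , wk , ≤ℓ) = ys , wk , ≤-trans ≤ℓ ℓ≤ℓ′

  shortWalk-reverse : ∀ {E a b ℓ} → SymmetricE E → (∀ a b → w a b ≡ w b a) →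
                      ShortWalk E a b ℓ → ShortWalk E b a ℓ
  shortWalk-reverse symE symw (ys , wk , ≤ℓ) with walk-reverse w symE symw wk
  ... | ysʳ , wkʳ , eq = ysʳ , wkʳ , ≤-trans (≤-reflexive eq) ≤ℓ

  shortWalk? : ∀ {E} → (∀ a b → E a b ≡ true → 1 ≤ w a b) → ∀ b ℓ a → Dec (ShortWalk E a b ℓ)
  shortWalk? {E} pos b = <-rec (λ ℓ → ∀ a → Dec (ShortWalk E a b ℓ)) decide
    where
    decide : ∀ ℓ → (∀ {ℓ′} → ℓ′ < ℓ → ∀ a → Dec (ShortWalk E a b ℓ′)) →
             ∀ a → Dec (ShortWalk E a b ℓ)
    decide ℓ rec a with a Fin.≟ b
    ... | yes refl = yes ([] , stop , z≤n)
    ... | no a≢b   = map′ extend first-step (Fin.any? via?)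
      where
      Via : Fin n → Set
      Via c = E a c ≡ true × w a c ≤ ℓ × ShortWalk E c b (ℓ ∸ w a c)

      via? : ∀ c → Dec (Via c)
      via? c with E a c in e
      ... | false = no λ { (() , _) }
      ... | true with w a c ≤? ℓ
      ...   | no  w≰ℓ = no (w≰ℓ ∘ proj₁ ∘ proj₂)
      ...   | yes w≤ℓ = map′ (λ rest → refl , w≤ℓ , rest) (proj₂ ∘ proj₂)
                             (rec (∸-monoʳ-< (pos a c e) w≤ℓ) c)

      extend : Σ (Fin n) Via → ShortWalk E a b ℓ
      extend (c , e , w≤ℓ , ys , wk , ≤rest) =
        c ∷ ys , step e wk , ≤-trans (+-monoʳ-≤ (w a c) ≤rest) (≤-reflexive (m+[n∸m]≡n w≤ℓ))

      first-step : ShortWalk E a b ℓ → Σ (Fin n) Via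
      first-step ([] , stop , _) = contradiction refl a≢b
      first-step (c ∷ ys , step e wk , ≤ℓ) =
        c , e , ≤-trans (m≤m+n _ _) ≤ℓ , ys , wk ,
        m+n≤o⇒m≤o∸n (wt w c ys) (≤-trans (≤-reflexive (+-comm (wt w c ys) (w a c))) ≤ℓ)

¬¬-least : (P : ℕ → Set) → ∀ m → P m → ¬ ¬ (Σ ℕ λ d → P d × (∀ d′ → P d′ → d ≤ d′))
¬¬-least P = <-rec (λ m → P m → ¬ ¬ (Σ ℕ λ d → P d × (∀ d′ → P d′ → d ≤ d′))) λ m rec pm →
  ¬¬-excluded-middle {A = Σ ℕ λ k → k < m × P k} >>= λ where
    (yes (k , k<m , pk)) → rec k<m pk
    (no none)            → pure (m , pm , λ d′ pd′ → ≮⇒≥ (λ d′<m → none (d′ , d′<m , pd′)))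

distTo-exists : ∀ {n} (E : EdgeSet n) w x C → ¬ ¬ Σ ℕ∞ (DistTo E w x C)
distTo-exists {n} E w x C = ¬¬-excluded-middle {A = Reachable} >>= λ where
    (no unreachable) → pure (∞ , λ xs c c∈ wk → unreachable (xs , c , c∈ , wk))
    (yes (xs , c , c∈ , wk)) → ¬¬-least WalkOfWeight (wt w x xs) (xs , c , c∈ , wk , refl) >>= λ where
      (d , walk-d , least) → pure (fin d , walk-d , λ ys c′ c′∈ wk′ → least _ (ys , c′ , c′∈ , wk′ , refl))
  where
  Reachable : Set
  Reachable = Σ (List (Fin n)) λ xs → Σ (Fin n) λ c → c ∈ C × WalkL E x xs c
  WalkOfWeight : ℕ → Set
  WalkOfWeight d = Σ (List (Fin n)) λ xs → Σ (Fin n) λ c → c ∈ C × WalkL E x xs c × wt w x xs ≡ d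

¬closer⇒walkInto : ∀ {n} (w : Fin n → Fin n → ℕ) {F E x C ℓ} →
                   ¬ CloserIn w F E x C → WalkInto w F x C ℓ → ¬ ¬ WalkInto w E x C ℓ
¬closer⇒walkInto w {F} {E} {x} {C} {ℓ} not-closer (zs , c , c∈ , wk , ≤ℓ) =
  distTo-exists F w x C >>= λ (d₁ , D₁) →
  distTo-exists E w x C >>= λ (d₂ , D₂) →
  pure (from-distances d₁ d₂ D₁ D₂ λ d₁<d₂ → not-closer (d₁ , d₂ , D₁ , D₂ , d₁<d₂))
  where
  from-distances : ∀ d₁ d₂ → DistTo F w x C d₁ → DistTo E w x C d₂ → ¬ d₁ <∞ d₂ → WalkInto w E x C ℓ
  from-distances ∞ _ unreachable _ _ = contradiction wk (unreachable zs c c∈)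
  from-distances (fin _) ∞ _ _ d₁≮∞ = contradiction tt d₁≮∞
  from-distances (fin _) (fin _) (_ , least) ((ys , c′ , c′∈ , wy , refl) , _) d₁≮d₂ =
    ys , c′ , c′∈ , wy , ≤-trans (≮⇒≥ d₁≮d₂) (≤-trans (least zs c c∈ wk) ≤ℓ)

module PathBuying {n} (G : EdgeSet n) (w : Fin n → Fin n → ℕ) (W : ℕ)
  (symG : SymmetricE G) (symw : ∀ a b → w a b ≡ w b a)
  (pos : ∀ a b → G a b ≡ true → 1 ≤ w a b) (≤W : ∀ a b → G a b ≡ true → w a b ≤ W)
  {k : ℕ} {s : CState n} (run : ClusterRun G k s) where

  open Clustering G symG k

  𝒞 : List (List (Fin n))
  𝒞 = clusters s

  G₀ : EdgeSet n
  G₀ = finalEdges G s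

  record Invariant (E : EdgeSet n) : Set where
    field
      symmetric : SymmetricE E
      ⊆G        : E ⊆E G
      G₀⊆       : G₀ ⊆E E
  open Invariant

  invariant₀ : Invariant G₀
  invariant₀ = record { symmetric = finalEdges-sym run ; ⊆G = finalEdges-⊆ run ; G₀⊆ = λ _ _ e → e }

  buyStep-⊆ : ∀ {E π E′} → BuyStep w W 𝒞 E π E′ → E ⊆E E′
  buyStep-⊆ (_ , _ , inj₁ (_ , eq)) a b e = trans (eq a b) (∨-trueˡ _ e)
  buyStep-⊆ (_ , _ , inj₂ (_ , eq)) a b e = trans (eq a b) e

  buyStep-invariant : ∀ {E u xs v E′} → BuyStep w W 𝒞 E (u , xs , v) E′ → WalkL G u xs v →
                      Invariant E → Invariant E′
  buyStep-invariant {E} {u} {xs} st@(_ , _ , inj₁ (_ , eq)) wk inv = record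
    { symmetric = λ a b → trans (eq a b) (trans (cong₂ _∨_ (symmetric inv a b) (pathE-sym u xs a b)) (sym (eq b a)))
    ; ⊆G        = λ a b e → [ ⊆G inv a b , pathE-⊆ symG wk a b ] (∨-true⁻ (E a b) (trans (sym (eq a b)) e))
    ; G₀⊆       = λ a b → buyStep-⊆ st a b ∘ G₀⊆ inv a b
    }
  buyStep-invariant st@(_ , _ , inj₂ (_ , eq)) wk inv = record
    { symmetric = λ a b → trans (eq a b) (trans (symmetric inv a b) (sym (eq b a)))
    ; ⊆G        = λ a b e → ⊆G inv a b (trans (sym (eq a b)) e)
    ; G₀⊆       = λ a b → buyStep-⊆ st a b ∘ G₀⊆ inv a b
    }

  buyRun-⊆ : ∀ {E ps H} → BuyRun w W 𝒞 E ps H → E ⊆E H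
  buyRun-⊆ done         a b e = e
  buyRun-⊆ (buy st rest) a b e = buyRun-⊆ rest a b (buyStep-⊆ st a b e)

  buyRun-invariant : ∀ {E ps H} → BuyRun w W 𝒞 E ps H → (∀ {u xs v} → (u , xs , v) ∈ ps → WalkL G u xs v) →
                     Invariant E → Invariant H
  buyRun-invariant done          walks inv = inv
  buyRun-invariant (buy st rest) walks inv =
    buyRun-invariant rest (walks ∘ there) (buyStep-invariant st (walks (here refl)) inv)

  walk-through-cluster : ∀ {E a b C ℓ₁ ℓ₂} → Invariant E → C ∈ 𝒞 →
                         WalkInto w E a C ℓ₁ → WalkInto w E b C ℓ₂ → ShortWalk w E a b (ℓ₁ + ℓ₂ + 2 * W)
  walk-through-cluster {E} {a} {b} {C} {ℓ₁} {ℓ₂} inv C∈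
                       (ys₁ , c₁ , c₁∈ , wk₁ , ≤ℓ₁) (ys₂ , c₂ , c₂∈ , wk₂ , ≤ℓ₂)
    with cluster-centre run C∈ | walk-reverse w (symmetric inv) symw wk₂
  ... | v , centre | ys₂ʳ , wk₂ʳ , wt-eq =
    ys₁ ++ v ∷ c₂ ∷ ys₂ʳ ,
    walk-++ wk₁ (step (trans (symmetric inv c₁ v) (spoke c₁∈)) (step (spoke c₂∈) wk₂ʳ)) ,
    (begin
      wt w a (ys₁ ++ v ∷ c₂ ∷ ys₂ʳ)
        ≡⟨ wt-++ w a ys₁ _ ⟩
      wt w a ys₁ + (w (last a ys₁) v + (w v c₂ + wt w c₂ ys₂ʳ))
        ≡⟨ cong (λ c → wt w a ys₁ + (w c v + _)) (walk-last wk₁) ⟩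
      wt w a ys₁ + (w c₁ v + (w v c₂ + wt w c₂ ys₂ʳ))
        ≤⟨ +-mono-≤ ≤ℓ₁ (+-mono-≤ (≤-trans (≤-reflexive (symw c₁ v)) (spoke-≤W c₁∈))
                                  (+-mono-≤ (spoke-≤W c₂∈) (≤-trans (≤-reflexive wt-eq) ≤ℓ₂))) ⟩
      ℓ₁ + (W + (W + ℓ₂))
        ≡⟨ rearrange ℓ₁ ℓ₂ W ⟩
      ℓ₁ + ℓ₂ + 2 * W
        ∎)
    where
    open ≤-Reasoning
    rearrange : ∀ x y z → x + (z + (z + y)) ≡ x + y + 2 * z
    rearrange = solve 3 (λ x y z → x :+ (z :+ (z :+ y)) := x :+ y :+ con 2 :* z) refl
      where open +-*-Solver
    spoke : ∀ {x} → x ∈ C → E v x ≡ true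
    spoke x∈ = G₀⊆ inv v _ (∨-trueˡ _ (proj₂ (centre _ x∈)))
    spoke-≤W : ∀ {x} → x ∈ C → w v x ≤ W
    spoke-≤W x∈ = ≤W v _ (proj₁ (centre _ x∈))

  cluster-detour : ∀ {E a xs b C y} → Invariant E → WalkL G a xs b → C ∈ 𝒞 → y ∈ C → y ∈ a ∷ xs →
                   ¬ CloserIn w (pathE a xs) E a C → ¬ CloserIn w (pathE a xs) E b C →
                   ¬ ¬ ShortWalk w E a b (wt w a xs + 2 * W)
  cluster-detour {E} {a} {xs} {b} {C} inv wk C∈ y∈C y∈π a-not-closer b-not-closer with ∈⇒split a xs y∈π
  ... | p , q , refl , refl with walk-++⁻ p (walk⇒pathE-walk wk)
  ...   | to-y , from-y with walk-reverse w (pathE-sym a (p ++ q)) symw from-y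
  ...     | qʳ , to-yʳ , wt-qʳ =
    ¬closer⇒walkInto w a-not-closer (p , last a p , y∈C , to-y , ≤-refl) >>= λ into₁ →
    ¬closer⇒walkInto w b-not-closer (qʳ , last a p , y∈C , to-yʳ , ≤-reflexive wt-qʳ) >>= λ into₂ →
    pure (shortWalk-weaken w (≤-reflexive (cong (_+ 2 * W) (sym (wt-++ w a p q))))
                             (walk-through-cluster inv C∈ into₁ into₂))

  cost≤[2W+1]*value : ∀ {E a xs b val} → Invariant E → WalkL G a xs b → Shortest w G a xs b →
    Card (ValuePair w 𝒞 E (a , xs , b)) val →
    (∀ {C y} → C ∈ 𝒞 → y ∈ C → y ∈ a ∷ xs →
       ¬ ¬ (ValuePair w 𝒞 E (a , xs , b) (a , C) ⊎ ValuePair w 𝒞 E (a , xs , b) (b , C))) →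
    cost E a xs ≤ (2 * W + 1) * val
  cost≤[2W+1]*value {E} {a} {xs} {b} inv wk shortest (L , _ , L⇔value , refl) valued = begin
    cost E a xs                     ≤⟨ cost≤tailCount E OnValuedCluster missing wk ⟩
    tailCount OnValuedCluster a xs  ≤⟨ tailCount-any (λ y pair → memb y (proj₂ pair)) L _ a xs per-pair ⟩
    length L * suc (2 * W)          ≡⟨ *-comm (length L) _ ⟩
    suc (2 * W) * length L          ≡⟨ cong (_* length L) (+-comm 1 (2 * W)) ⟩
    (2 * W + 1) * length L          ∎
    where
    open ≤-Reasoning

    OnValuedCluster : Fin n → Bool
    OnValuedCluster y = any (λ pair → memb y (proj₂ pair)) L

    missing : ∀ y z → y ∈ a ∷ xs → G y z ≡ true → E y z ≡ false → OnValuedCluster y ≡ true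
    missing y z y∈π g ¬e with clustered⇒∈cluster run y (finalEdges-missing s g (⊆E-false (G₀⊆ inv) ¬e))
    ... | C , C∈ , y∈C = decidable-stable (OnValuedCluster y ≟ true) (¬¬-map [ on a , on b ] (valued C∈ y∈C y∈π))
      where
      on : ∀ x → ValuePair w 𝒞 E (a , xs , b) (x , C) → OnValuedCluster y ≡ true
      on x value = any-true _ (Equivalence.from (L⇔value (x , C)) value) (∈⇒memb y∈C)

    per-pair : ∀ pair → pair ∈ L → tailCount (λ y → memb y (proj₂ pair)) a xs ≤ suc (2 * W)
    per-pair (x , C) pair∈ with Equivalence.to (L⇔value (x , C)) pair∈
    ... | _ , C∈ , _ with cluster-centre run C∈
    ...   | v , centre = tailCount-spread w _ pos (2 * W) wk (shortest⇒spread w _ symG symw centred wk shortest)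
      where
      centred : ∀ x → memb x C ≡ true → G v x ≡ true × w v x ≤ W
      centred x x∈ = proj₁ (centre x (memb⇒∈ C x∈)) , ≤W v x (proj₁ (centre x (memb⇒∈ C x∈)))

  unbought-path : ∀ {E a xs b val} → Invariant E → WalkL G a xs b → Shortest w G a xs b →
                  Card (ValuePair w 𝒞 E (a , xs , b)) val → (2 * W + 1) * val < cost E a xs →
                  ¬ ¬ ShortWalk w E a b (wt w a xs + 2 * W)
  unbought-path {E} {a} {xs} {b} inv wk shortest value cost> no-short-walk =
    <⇒≱ cost> (cost≤[2W+1]*value inv wk shortest value valued)
    where
    valued : ∀ {C y} → C ∈ 𝒞 → y ∈ C → y ∈ a ∷ xs →
             ¬ ¬ (ValuePair w 𝒞 E (a , xs , b) (a , C) ⊎ ValuePair w 𝒞 E (a , xs , b) (b , C))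
    valued C∈ y∈C y∈π neither = cluster-detour inv wk C∈ y∈C y∈π
      (λ closer → neither (inj₁ (inj₁ refl , C∈ , (_ , y∈C , y∈π) , closer)))
      (λ closer → neither (inj₂ (inj₂ refl , C∈ , (_ , y∈C , y∈π) , closer)))
      no-short-walk

  buyRun-stretch : ∀ {E ps H} → BuyRun w W 𝒞 E ps H → (∀ {u xs v} → (u , xs , v) ∈ ps → WalkL G u xs v) →
                   Invariant E → ∀ {a xs b} → (a , xs , b) ∈ ps → Shortest w G a xs b →
                   ¬ ¬ ShortWalk w H a b (wt w a xs + 2 * W)
  buyRun-stretch (buy st rest) walks inv (there π∈) shortest =
    buyRun-stretch rest (walks ∘ there) (buyStep-invariant st (walks (here refl)) inv) π∈ shortest
  buyRun-stretch (buy (_ , _ , inj₁ (_ , eq)) rest) walks inv (here refl) shortest =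
    pure (_ , walk-mono (⊆E-trans (λ x y e → trans (eq x y) (∨-trueʳ _ e)) (buyRun-⊆ rest))
                        (walk⇒pathE-walk (walks (here refl))) ,
          m≤m+n _ _)
  buyRun-stretch (buy st@(_ , value , inj₂ (cost> , _)) rest) walks inv (here refl) shortest =
    ¬¬-map (shortWalk-mono w (⊆E-trans (buyStep-⊆ st) (buyRun-⊆ rest)))
           (unbought-path inv (walks (here refl)) shortest value cost>)

  path-stretch : ∀ {ps H} → BuyRun w W 𝒞 G₀ ps H → (∀ {u xs v} → (u , xs , v) ∈ ps → WalkL G u xs v) →
                 ∀ {a xs b} → (a , xs , b) ∈ ps → Shortest w G a xs b →
                 ShortWalk w H a b (wt w a xs + 2 * W)
  path-stretch buying walks π∈ shortest =
    decidable-stable (shortWalk? w (λ x y → pos x y ∘ ⊆G (buyRun-invariant buying walks invariant₀) x y) _ _ _)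
                     (buyRun-stretch buying walks invariant₀ π∈ shortest)

-- The cluster size k and the termination of the clustering loop only bound the size of H, not its
-- stretch.
mainTheorem1 : ∀ {n} (G : EdgeSet n) (w : Fin n → Fin n → ℕ) (W : ℕ) (S : Fin n → Bool) →
    IsWeightedGraph G w W →
    (k : ℕ) → IsCeilSqrt (card S * W) k →
    (s : CState n) → ClusterRun G k s → Terminal G k s →
    (ps : List (Path n)) → ShortestPathSystem G w S ps →
    (H : EdgeSet n) → BuyRun w W (clusters s) (finalEdges G s) ps H →
    ∀ u v → S u ≡ true → S v ≡ true →
    ∀ xs → WalkL G u xs v →
    Σ (List (Fin n)) λ ys → WalkL H u ys v × wt w u ys ≤ wt w u xs + 2 * W
mainTheorem1 G w W S (symG , _ , symw , bounds) k _ s run _ ps (paths , one-path) H buying u v Su Sv xs wk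
  with u Fin.≟ v
... | yes refl = [] , stop , z≤n
... | no u≢v with countᵇ-pos⇒∃ _ ps (≤-reflexive (sym (one-path u v Su Sv u≢v)))
... | (a , zs , b) , π∈ , ends with paths a zs b π∈
... | _ , _ , _ , _ , shortest = orient (∨-true⁻ (a == u ∧ b == v) ends)
  where
  open PathBuying G w W symG symw (λ x y → proj₁ ∘ bounds x y) (λ x y → proj₂ ∘ bounds x y) run

  walks : ∀ {a xs b} → (a , xs , b) ∈ ps → WalkL G a xs b
  walks π∈ = proj₁ (proj₂ (proj₂ (proj₂ (paths _ _ _ π∈))))

  orient : (a == u ∧ b == v) ≡ true ⊎ (a == v ∧ b == u) ≡ true → ShortWalk w H u v (wt w u xs + 2 * W)
  orient (inj₁ same) with ==⇒≡ a u (∧-conicalˡ _ _ same) | ==⇒≡ b v (∧-conicalʳ _ _ same)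
  ... | refl | refl = shortWalk-weaken w (+-monoˡ-≤ (2 * W) (shortest xs wk)) (path-stretch buying walks π∈ shortest)
  orient (inj₂ swapped) with ==⇒≡ a v (∧-conicalˡ _ _ swapped) | ==⇒≡ b u (∧-conicalʳ _ _ swapped)
  ... | refl | refl with walk-reverse w symG symw wk
  ...   | xsʳ , wkʳ , wt-xsʳ =
    shortWalk-weaken w (+-monoˡ-≤ (2 * W) (≤-trans (shortest xsʳ wkʳ) (≤-reflexive wt-xsʳ)))
      (shortWalk-reverse w (Invariant.symmetric (buyRun-invariant buying walks invariant₀)) symw
        (path-stretch buying walks π∈ shortest))
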